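{- Let $b_0,b_1,b_2,\dots$ be indeterminates, $B(x)=\sum_{i\ge0}b_ix^i$, and let $g(x)$ be the unique formal power series with $g(x)=1+xg(x)B(x^2g(x))$. For a positive integer $m$, an integer $r\ge0$ and an integer $m_r\ge0$, let $\left(m\,|\,b_r^{m_r}\right)$ denote the coefficient of the monomial $b_r^{m_r}$ in $[x^{m_r(2r+1)}]g^m(x)$. Then $$\left(m\,|\,b_r^{m_r}\right)=[x^{m_r}]\mathcal{B}_{r+1}(x)^m=\frac{m}{m+rm_r}\binom{m+rm_r+m_r-1}{m_r}.$$
   Context: $[x^n]F(x)$ denotes the coefficient of $x^n$ in $F$. The generalized binomial series $\mathcal{B}_r(x)$ is defined by $\mathcal{B}_r(x)^m=\sum_{n\ge0}\frac{m}{m+rn}\binom{m+rn}{n}x^n$. -}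

module Defs where

open import Data.Nat using (ℕ; zero; suc; _+_; _*_; _∸_; _≡ᵇ_)
open import Data.Nat.Combinatorics using (_C_)
open import Data.Bool using (Bool; true; false; _∧_; if_then_else_)
open import Data.List using (List; []; _∷_; map; concatMap; upTo; zipWith; foldr)
open import Data.Nat.ListAction using (sum)
open import Relation.Binary.PropositionalEquality using (_≡_)

-- A monomial b₀^{e₀} b₁^{e₁} ⋯ b_k^{e_k} is represented by its exponent
-- list (e₀ ∷ e₁ ∷ ⋯ ∷ e_k ∷ []); lists differing by trailing zeros
-- denote the same monomial.

Mono : Set
Mono = List ℕ

Poly : Set
Poly = Mono → ℕ

allZero : Mono → Bool
allZero []       = true
allZero (e ∷ μ)  = (e ≡ᵇ 0) ∧ allZero μ

divisors : Mono → List Mono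
divisors []       = [] ∷ []
divisors (e ∷ μ)  = concatMap (λ k → map (k ∷_) (divisors μ)) (upTo (suc e))

monoDiv : Mono → Mono → Mono
monoDiv μ ν = zipWith _∸_ μ ν

0ₚ : Poly
0ₚ _ = 0

1ₚ : Poly
1ₚ μ = if allZero μ then 1 else 0

bvar : ℕ → Poly
bvar zero    []       = 0
bvar zero    (e ∷ μ)  = if (e ≡ᵇ 1) ∧ allZero μ then 1 else 0
bvar (suc i) []       = 0
bvar (suc i) (e ∷ μ)  = if e ≡ᵇ 0 then bvar i μ else 0

_+ₚ_ : Poly → Poly → Poly
(p +ₚ q) μ = p μ + q μ

_*ₚ_ : Poly → Poly → Poly
(p *ₚ q) μ = sum (map (λ ν → p ν * q (monoDiv μ ν)) (divisors μ))

sumₚ : List Poly → Poly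
sumₚ = foldr _+ₚ_ 0ₚ

Series : Set
Series = ℕ → Poly

1ₛ : Series
1ₛ zero    = 1ₚ
1ₛ (suc n) = 0ₚ

_+ₛ_ : Series → Series → Series
(f +ₛ h) n = f n +ₚ h n

_*ₛ_ : Series → Series → Series
(f *ₛ h) n = sumₚ (map (λ k → f k *ₚ h (n ∸ k)) (upTo (suc n)))

_^ₛ_ : Series → ℕ → Series
f ^ₛ zero    = 1ₛ
f ^ₛ suc k   = f *ₛ (f ^ₛ k)

xₛ* : Series → Series
xₛ* f zero    = 0ₚ
xₛ* f (suc n) = f n

x²ₛ* : Series → Series
x²ₛ* f zero          = 0ₚ
x²ₛ* f (suc zero)    = 0ₚ
x²ₛ* f (suc (suc n)) = f n

-- B(y) = Σ_{i ≥ 0} b_i yⁱ  for a series y with zero constant term;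
-- then only i ≤ n contribute to [xⁿ] B(y).
B∘ : Series → Series
B∘ y n = sumₚ (map (λ i → bvar i *ₚ (y ^ₛ i) n) (upTo (suc n)))

IsG : Series → Set
IsG g = ∀ n μ → g n μ ≡ (1ₛ +ₛ xₛ* (g *ₛ B∘ (x²ₛ* g))) n μ

bpow : ℕ → ℕ → Mono
bpow zero    k = k ∷ []
bpow (suc r) k = 0 ∷ bpow r k

-- Generalized binomial series:  [xⁿ] 𝓑_r(x)^m = m/(m+rn) · C(m+rn, n).
-- For m ≥ 1, "c = [xⁿ] 𝓑_r(x)^m" is expressed without division as
-- (m + r n) · c = m · C(m + r n, n).
IsBinomCoeff : ℕ → ℕ → ℕ → ℕ → Set
IsBinomCoeff r m n c = (m + r * n) * c ≡ m * ((m + r * n) C n)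

module Submission where

-- Keeping only the monomials b_r^k of the coefficients is a semiring homomorphism from
-- power series over ℕ[b₀,b₁,…] to ℕ[[t]][[x]] (t standing for b_r); it sends B(y) to t·y^r,
-- so the image G of g satisfies G = 1 + t x^{2r+1} G^{r+1}, whence
-- G^{m+1} = G^m + t x^{2r+1} G^{m+r+1}.  On the diagonal coefficients
-- T(m,k) = [t^k x^{k(2r+1)}] G^m this reads T(m+1,k+1) = T(m,k+1) + T(m+r+1,k),
-- with T(m,0) = 1 and T(0,k+1) = 0.  These conditions determine T, and by the absorption
-- identity for binomial coefficients the numbers m/(m+(r+1)k)·C(m+(r+1)k,k) satisfy them.

open import Level using (Level)
open import Algebra.Bundles using (Semiring)

module SemiringSum {c ℓ : Level} (R : Semiring c ℓ) where
  open import Data.Nat using (ℕ; zero; suc; _≤_; z≤n; s≤s)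
  open import Data.Nat.Properties using (suc-injective)
  open import Data.List using (List; []; _∷_; map; foldr; applyUpTo)
  open import Relation.Binary.PropositionalEquality using (_≢_)
  open Semiring R renaming (Carrier to A) hiding (zero)

  ∑ : List A → A
  ∑ = foldr _+_ 0#

  ∑-map-cong : ∀ {B : Set} {f g : B → A} → (∀ x → f x ≈ g x) →
               ∀ xs → ∑ (map f xs) ≈ ∑ (map g xs)
  ∑-map-cong f≈g []       = refl
  ∑-map-cong f≈g (x ∷ xs) = +-cong (f≈g x) (∑-map-cong f≈g xs)

  ∑-applyUpTo-zero : ∀ {f : ℕ → A} → (∀ i → f i ≈ 0#) → ∀ n → ∑ (applyUpTo f n) ≈ 0#
  ∑-applyUpTo-zero f≈0 zero    = refl
  ∑-applyUpTo-zero f≈0 (suc n) =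
    trans (+-cong (f≈0 0) (∑-applyUpTo-zero (λ i → f≈0 (suc i)) n)) (+-identityʳ 0#)

  ∑-applyUpTo-single : ∀ (f : ℕ → A) n s → (∀ i → i ≢ s → f i ≈ 0#) →
                       (n ≤ s → f s ≈ 0#) → ∑ (applyUpTo f n) ≈ f s
  ∑-applyUpTo-single f zero    s       _     n≤s⇒0 = sym (n≤s⇒0 z≤n)
  ∑-applyUpTo-single f (suc n) zero    i≢0⇒0 _     =
    trans (+-cong refl (∑-applyUpTo-zero (λ i → i≢0⇒0 (suc i) λ ()) n)) (+-identityʳ _)
  ∑-applyUpTo-single f (suc n) (suc s) i≢s⇒0 n≤s⇒0 =
    trans (+-cong (i≢s⇒0 0 λ ()) (∑-applyUpTo-single (λ i → f (suc i)) n s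
                                   (λ i i≢s → i≢s⇒0 (suc i) (λ eq → i≢s (suc-injective eq)))
                                   (λ n≤s → n≤s⇒0 (s≤s n≤s))))
          (+-identityˡ _)

module FormalPowerSeries {c ℓ : Level} (R : Semiring c ℓ) where
  open import Data.Nat as ℕ using (ℕ; zero; suc; _<_; _∸_; s≤s)
  import Data.Nat.Properties as ℕₚ
  open import Data.List using (map; upTo; applyUpTo)
  open import Data.List.Properties using (map-upTo)
  open import Data.Product using (_,_)
  import Relation.Binary.PropositionalEquality as ≡
  open Semiring R renaming (Carrier to A) hiding (zero)
  import Relation.Binary.Reasoning.Setoid

  private
    module ≈-Reasoning = Relation.Binary.Reasoning.Setoid setoid
  open SemiringSum R using (∑)

  FPS : Set c
  FPS = ℕ → A

  infix  4 _≋_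
  infixl 6 _⊕_
  infixl 7 _⊛_ _⋆_
  infixr 8 _^_
  infixr 7.5 x·_ x^_·_

  _≋_ : FPS → FPS → Set ℓ
  f ≋ h = ∀ n → f n ≈ h n

  𝟘 𝟙 : FPS
  𝟘 _       = 0#
  𝟙 zero    = 1#
  𝟙 (suc _) = 0#

  _⊕_ : FPS → FPS → FPS
  (f ⊕ h) n = f n + h n

  _⋆_ : A → FPS → FPS
  (a ⋆ f) n = a * f n

  x·_ : FPS → FPS
  (x· f) zero    = 0#
  (x· f) (suc n) = f n

  x^_·_ : ℕ → FPS → FPS
  x^ zero  · f = f
  x^ suc j · f = x· (x^ j · f)

  tail : FPS → FPS
  tail f n = f (suc n)

  _⊛_ : FPS → FPS → FPS
  (f ⊛ h) zero    = f 0 * h 0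
  (f ⊛ h) (suc n) = f 0 * h (suc n) + (tail f ⊛ h) n

  _^_ : FPS → ℕ → FPS
  f ^ zero  = 𝟙
  f ^ suc k = f ⊛ f ^ k

  ≋-refl : ∀ {f} → f ≋ f
  ≋-refl n = refl

  ≋-sym : ∀ {f h} → f ≋ h → h ≋ f
  ≋-sym f≋h n = sym (f≋h n)

  ≋-trans : ∀ {f g h} → f ≋ g → g ≋ h → f ≋ h
  ≋-trans f≋g g≋h n = trans (f≋g n) (g≋h n)

  x·-cong : ∀ {f h} → f ≋ h → x· f ≋ x· h
  x·-cong f≋h zero    = refl
  x·-cong f≋h (suc n) = f≋h n

  x^·-cong : ∀ j {f h} → f ≋ h → x^ j · f ≋ x^ j · h
  x^·-cong zero    f≋h = f≋h
  x^·-cong (suc j) f≋h = x·-cong (x^·-cong j f≋h)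

  ⊕-cong : ∀ {f f′ h h′} → f ≋ f′ → h ≋ h′ → f ⊕ h ≋ f′ ⊕ h′
  ⊕-cong f≋f′ h≋h′ n = +-cong (f≋f′ n) (h≋h′ n)

  ⋆-cong : ∀ a {f h} → f ≋ h → a ⋆ f ≋ a ⋆ h
  ⋆-cong a f≋h n = *-cong refl (f≋h n)

  ⊛-cong : ∀ {f f′ h h′} → f ≋ f′ → h ≋ h′ → f ⊛ h ≋ f′ ⊛ h′
  ⊛-cong f≋f′ h≋h′ zero    = *-cong (f≋f′ 0) (h≋h′ 0)
  ⊛-cong f≋f′ h≋h′ (suc n) =
    +-cong (*-cong (f≋f′ 0) (h≋h′ (suc n))) (⊛-cong (λ j → f≋f′ (suc j)) h≋h′ n)

  ⊛-zeroˡ : ∀ h → 𝟘 ⊛ h ≋ 𝟘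
  ⊛-zeroˡ h zero    = zeroˡ (h 0)
  ⊛-zeroˡ h (suc n) = trans (+-cong (zeroˡ _) (⊛-zeroˡ h n)) (+-identityˡ 0#)

  ⊛-zeroʳ : ∀ f → f ⊛ 𝟘 ≋ 𝟘
  ⊛-zeroʳ f zero    = zeroʳ (f 0)
  ⊛-zeroʳ f (suc n) = trans (+-cong (zeroʳ _) (⊛-zeroʳ (tail f) n)) (+-identityˡ 0#)

  ⊛-identityˡ : ∀ h → 𝟙 ⊛ h ≋ h
  ⊛-identityˡ h zero    = *-identityˡ (h 0)
  ⊛-identityˡ h (suc n) = trans (+-cong (*-identityˡ _) (⊛-zeroˡ h n)) (+-identityʳ _)

  ⊛-identityʳ : ∀ f → f ⊛ 𝟙 ≋ f
  ⊛-identityʳ f zero    = *-identityʳ (f 0)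
  ⊛-identityʳ f (suc n) = trans (+-cong (zeroʳ _) (⊛-identityʳ (tail f) n)) (+-identityˡ _)

  private
    +-interchange : ∀ a b x y → (a + b) + (x + y) ≈ (a + x) + (b + y)
    +-interchange a b x y = begin
      (a + b) + (x + y) ≈⟨ +-assoc a b (x + y) ⟩
      a + (b + (x + y)) ≈⟨ +-cong refl (sym (+-assoc b x y)) ⟩
      a + ((b + x) + y) ≈⟨ +-cong refl (+-cong (+-comm b x) refl) ⟩
      a + ((x + b) + y) ≈⟨ +-cong refl (+-assoc x b y) ⟩
      a + (x + (b + y)) ≈⟨ sym (+-assoc a x (b + y)) ⟩
      (a + x) + (b + y) ∎
      where open ≈-Reasoning

    central-swap : ∀ {a} → (∀ b → b * a ≈ a * b) → ∀ b y → b * (a * y) ≈ a * (b * y)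
    central-swap {a} central b y = begin
      b * (a * y) ≈⟨ *-assoc b a y ⟨
      (b * a) * y ≈⟨ *-cong (central b) refl ⟩
      (a * b) * y ≈⟨ *-assoc a b y ⟩
      a * (b * y) ∎
      where open ≈-Reasoning

  ⊛-distribʳ-⊕ : ∀ h f f′ → (f ⊕ f′) ⊛ h ≋ f ⊛ h ⊕ f′ ⊛ h
  ⊛-distribʳ-⊕ h f f′ zero    = distribʳ (h 0) (f 0) (f′ 0)
  ⊛-distribʳ-⊕ h f f′ (suc n) =
    trans (+-cong (distribʳ _ _ _) (⊛-distribʳ-⊕ h (tail f) (tail f′) n)) (+-interchange _ _ _ _)

  ⊛-distribˡ-⊕ : ∀ f h h′ → f ⊛ (h ⊕ h′) ≋ f ⊛ h ⊕ f ⊛ h′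
  ⊛-distribˡ-⊕ f h h′ zero    = distribˡ (f 0) (h 0) (h′ 0)
  ⊛-distribˡ-⊕ f h h′ (suc n) =
    trans (+-cong (distribˡ _ _ _) (⊛-distribˡ-⊕ (tail f) h h′ n)) (+-interchange _ _ _ _)

  ⋆-⊛-assoc : ∀ a f h → (a ⋆ f) ⊛ h ≋ a ⋆ (f ⊛ h)
  ⋆-⊛-assoc a f h zero    = *-assoc a (f 0) (h 0)
  ⋆-⊛-assoc a f h (suc n) =
    trans (+-cong (*-assoc _ _ _) (⋆-⊛-assoc a (tail f) h n)) (sym (distribˡ _ _ _))

  ⊛-⋆-comm : ∀ a → (∀ b → b * a ≈ a * b) → ∀ f h → f ⊛ (a ⋆ h) ≋ a ⋆ (f ⊛ h)
  ⊛-⋆-comm a central f h zero    = central-swap central (f 0) (h 0)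
  ⊛-⋆-comm a central f h (suc n) =
    trans (+-cong (central-swap central (f 0) (h (suc n))) (⊛-⋆-comm a central (tail f) h n))
          (sym (distribˡ _ _ _))

  ⊛-x·ˡ : ∀ f h → (x· f) ⊛ h ≋ x· (f ⊛ h)
  ⊛-x·ˡ f h zero    = zeroˡ (h 0)
  ⊛-x·ˡ f h (suc n) = trans (+-cong (zeroˡ _) refl) (+-identityˡ _)

  ⊛-x·ʳ : ∀ f h → f ⊛ (x· h) ≋ x· (f ⊛ h)
  ⊛-x·ʳ f h zero          = zeroʳ (f 0)
  ⊛-x·ʳ f h (suc zero)    = trans (+-cong refl (⊛-x·ʳ (tail f) h zero)) (+-identityʳ _)
  ⊛-x·ʳ f h (suc (suc n)) = +-cong refl (⊛-x·ʳ (tail f) h (suc n))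

  ⊛-x^·ˡ : ∀ j f h → (x^ j · f) ⊛ h ≋ x^ j · (f ⊛ h)
  ⊛-x^·ˡ zero    f h = ≋-refl
  ⊛-x^·ˡ (suc j) f h = ≋-trans (⊛-x·ˡ (x^ j · f) h) (x·-cong (⊛-x^·ˡ j f h))

  ⊛-x^·ʳ : ∀ j f h → f ⊛ (x^ j · h) ≋ x^ j · (f ⊛ h)
  ⊛-x^·ʳ zero    f h = ≋-refl
  ⊛-x^·ʳ (suc j) f h = ≋-trans (⊛-x·ʳ f (x^ j · h)) (x·-cong (⊛-x^·ʳ j f h))

  ⊛-unfoldˡ : ∀ f h → f ⊛ h ≋ f 0 ⋆ h ⊕ x· (tail f ⊛ h)
  ⊛-unfoldˡ f h zero    = sym (+-identityʳ _)
  ⊛-unfoldˡ f h (suc n) = refl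

  ⊛-assoc : ∀ f g h → (f ⊛ g) ⊛ h ≋ f ⊛ (g ⊛ h)
  ⊛-assoc f g h n = begin
    ((f ⊛ g) ⊛ h) n
      ≈⟨ ⊛-cong (⊛-unfoldˡ f g) ≋-refl n ⟩
    ((f 0 ⋆ g ⊕ x· (tail f ⊛ g)) ⊛ h) n
      ≈⟨ ⊛-distribʳ-⊕ h (f 0 ⋆ g) _ n ⟩
    ((f 0 ⋆ g) ⊛ h) n + ((x· (tail f ⊛ g)) ⊛ h) n
      ≈⟨ +-cong (⋆-⊛-assoc (f 0) g h n) (⊛-x·ˡ _ h n) ⟩
    f 0 * (g ⊛ h) n + (x· ((tail f ⊛ g) ⊛ h)) n
      ≈⟨ +-cong refl (x·-assoc n) ⟩
    f 0 * (g ⊛ h) n + (x· (tail f ⊛ (g ⊛ h))) n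
      ≈⟨ ⊛-unfoldˡ f (g ⊛ h) n ⟨
    (f ⊛ (g ⊛ h)) n ∎
    where
    open ≈-Reasoning
    x·-assoc : ∀ n → (x· ((tail f ⊛ g) ⊛ h)) n ≈ (x· (tail f ⊛ (g ⊛ h))) n
    x·-assoc zero    = refl
    x·-assoc (suc n) = ⊛-assoc (tail f) g h n

  semiring : Semiring c ℓ
  semiring = record
    { Carrier = FPS ; _≈_ = _≋_ ; _+_ = _⊕_ ; _*_ = _⊛_ ; 0# = 𝟘 ; 1# = 𝟙
    ; isSemiring = record
      { isSemiringWithoutAnnihilatingZero = record
        { +-isCommutativeMonoid = record
          { isMonoid = record
            { isSemigroup = record
              { isMagma = record
                { isEquivalence = record { refl = ≋-refl ; sym = ≋-sym ; trans = ≋-trans }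
                ; ∙-cong = ⊕-cong }
              ; assoc = λ f g h n → +-assoc (f n) (g n) (h n) }
            ; identity = (λ f n → +-identityˡ (f n)) , (λ f n → +-identityʳ (f n)) }
          ; comm = λ f h n → +-comm (f n) (h n) }
        ; *-cong = ⊛-cong
        ; *-assoc = ⊛-assoc
        ; *-identity = ⊛-identityˡ , ⊛-identityʳ
        ; distrib = ⊛-distribˡ-⊕ , ⊛-distribʳ-⊕ }
      ; zero = ⊛-zeroˡ , ⊛-zeroʳ } }

  ^-cong : ∀ {f h} → f ≋ h → ∀ i → f ^ i ≋ h ^ i
  ^-cong f≋h zero    = ≋-refl
  ^-cong f≋h (suc i) = ⊛-cong f≋h (^-cong f≋h i)

  ^-+ : ∀ f a b → f ^ a ⊛ f ^ b ≋ f ^ (a ℕ.+ b)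
  ^-+ f zero    b = ⊛-identityˡ (f ^ b)
  ^-+ f (suc a) b = ≋-trans (⊛-assoc f (f ^ a) (f ^ b)) (⊛-cong ≋-refl (^-+ f a b))

  ⊛-vanishʳ : ∀ f h i → (∀ n → n < i → h n ≈ 0#) → ∀ n → n < i → (f ⊛ h) n ≈ 0#
  ⊛-vanishʳ f h i h≈0 zero    0<i = trans (*-cong refl (h≈0 0 0<i)) (zeroʳ _)
  ⊛-vanishʳ f h i h≈0 (suc n) n<i =
    trans (+-cong (trans (*-cong refl (h≈0 (suc n) n<i)) (zeroʳ _))
                  (⊛-vanishʳ (tail f) h i h≈0 n (ℕₚ.<-trans (ℕₚ.n<1+n n) n<i)))
          (+-identityˡ 0#)

  ^-vanish : ∀ f → f 0 ≈ 0# → ∀ i n → n < i → (f ^ i) n ≈ 0#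
  ^-vanish f f0≈0 (suc i) zero    _         = trans (*-cong f0≈0 refl) (zeroˡ _)
  ^-vanish f f0≈0 (suc i) (suc n) (s≤s n<i) =
    trans (+-cong (trans (*-cong f0≈0 refl) (zeroˡ _))
                  (⊛-vanishʳ (tail f) (f ^ i) i (^-vanish f f0≈0 i) n n<i))
          (+-identityˡ 0#)

  x^·-coeff : ∀ j f n → (x^ j · f) (n ℕ.+ j) ≡.≡ f n
  x^·-coeff zero    f n rewrite ℕₚ.+-identityʳ n = ≡.refl
  x^·-coeff (suc j) f n rewrite ℕₚ.+-suc n j     = x^·-coeff j f n

  ⊛-coeff : ∀ f h n → (f ⊛ h) n ≈ ∑ (map (λ j → f j * h (n ∸ j)) (upTo (suc n)))
  ⊛-coeff f h n =
    trans (⊛-coeff-applyUpTo f h n) (reflexive (≡.cong ∑ (≡.sym (map-upTo _ (suc n)))))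
    where
    ⊛-coeff-applyUpTo : ∀ f h n → (f ⊛ h) n ≈ ∑ (applyUpTo (λ j → f j * h (n ∸ j)) (suc n))
    ⊛-coeff-applyUpTo f h zero    = sym (+-identityʳ _)
    ⊛-coeff-applyUpTo f h (suc n) = +-cong refl (⊛-coeff-applyUpTo (tail f) h n)

  ^-suc-fixedPoint : ∀ a j e G → G ≋ 𝟙 ⊕ x^ j · (a ⋆ G ^ e) →
                     ∀ m → G ^ suc m ≋ G ^ m ⊕ x^ j · (a ⋆ G ^ (e ℕ.+ m))
  ^-suc-fixedPoint a j e G G-eq m = begin
    G ⊛ G ^ m
      ≈⟨ ⊛-cong G-eq ≋-refl ⟩
    (𝟙 ⊕ x^ j · (a ⋆ G ^ e)) ⊛ G ^ m
      ≈⟨ ⊛-distribʳ-⊕ (G ^ m) 𝟙 _ ⟩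
    𝟙 ⊛ G ^ m ⊕ (x^ j · (a ⋆ G ^ e)) ⊛ G ^ m
      ≈⟨ ⊕-cong (⊛-identityˡ (G ^ m)) (⊛-x^·ˡ j _ (G ^ m)) ⟩
    G ^ m ⊕ x^ j · ((a ⋆ G ^ e) ⊛ G ^ m)
      ≈⟨ ⊕-cong ≋-refl (x^·-cong j (⋆-⊛-assoc a (G ^ e) (G ^ m))) ⟩
    G ^ m ⊕ x^ j · (a ⋆ (G ^ e ⊛ G ^ m))
      ≈⟨ ⊕-cong ≋-refl (x^·-cong j (⋆-cong a (^-+ G e m))) ⟩
    G ^ m ⊕ x^ j · (a ⋆ G ^ (e ℕ.+ m)) ∎
    where open Relation.Binary.Reasoning.Setoid (Semiring.setoid semiring)

  x^·-+ : ∀ j k f → x^ j · x^ k · f ≋ x^ (j ℕ.+ k) · f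
  x^·-+ zero    k f = ≋-refl
  x^·-+ (suc j) k f = x·-cong (x^·-+ j k f)

  ⋆-x^· : ∀ a j f → a ⋆ x^ j · f ≋ x^ j · (a ⋆ f)
  ⋆-x^· a zero    f = ≋-refl
  ⋆-x^· a (suc j) f = ≋-trans ⋆-x· (x·-cong (⋆-x^· a j f))
    where
    ⋆-x· : a ⋆ x· (x^ j · f) ≋ x· (a ⋆ x^ j · f)
    ⋆-x· zero    = zeroʳ a
    ⋆-x· (suc n) = refl

  ^-x^· : ∀ j f i → (x^ j · f) ^ i ≋ x^ (i ℕ.* j) · f ^ i
  ^-x^· j f zero    = ≋-refl
  ^-x^· j f (suc i) = begin
    (x^ j · f) ⊛ (x^ j · f) ^ i            ≈⟨ ⊛-cong ≋-refl (^-x^· j f i) ⟩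
    (x^ j · f) ⊛ x^ (i ℕ.* j) · f ^ i      ≈⟨ ⊛-x^·ˡ j f _ ⟩
    x^ j · (f ⊛ x^ (i ℕ.* j) · f ^ i)      ≈⟨ x^·-cong j (⊛-x^·ʳ (i ℕ.* j) f (f ^ i)) ⟩
    x^ j · x^ (i ℕ.* j) · f ^ suc i        ≈⟨ x^·-+ j (i ℕ.* j) (f ^ suc i) ⟩
    x^ (suc i ℕ.* j) · f ^ suc i           ∎
    where open Relation.Binary.Reasoning.Setoid (Semiring.setoid semiring)

open import Defs
open import Data.Nat using (ℕ; zero; suc; _+_; _*_; _∸_; _≤_; s≤s; z≤n; ≢-nonZero)
open import Data.Nat.Properties
  using (+-*-semiring; +-comm; *-comm; *-zeroʳ; +-identityʳ; +-cancelʳ-≡; *-cancelˡ-≡; m+1+n≢0)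
open import Data.Nat.Tactic.RingSolver using (solve-∀)
open import Data.Nat.ListAction using (sum)
open import Data.Nat.Combinatorics using (_C_; nC1≡n; nCk+nC[k+1]≡[n+1]C[k+1])
open import Data.List using (List; []; _∷_; map; upTo; applyUpTo; concatMap; _++_)
open import Data.List.Properties using (map-cong; map-∘; map-upTo; ++-identityʳ)
open import Data.Product using (_×_; _,_)
open import Function using (_∘_)
open import Relation.Binary.PropositionalEquality
open import Relation.Nullary using (contradiction)
import Relation.Binary.Reasoning.Setoid as SetoidReasoning

-- (k+1)·C(n,k+1) = (n−k)·C(n,k), with the subtraction moved across.
C-absorbˡ : ∀ n k → suc k * (n C suc k) + k * (n C k) ≡ n * (n C k)
C-absorbˡ zero    zero    = refl
C-absorbˡ zero    (suc k) rewrite *-zeroʳ (suc (suc k)) = refl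
C-absorbˡ (suc n) zero    rewrite nC1≡n (suc n) | +-identityʳ (1 * suc n) = *-comm 1 (suc n)
C-absorbˡ (suc n) (suc k) = begin
  suc (suc k) * (suc n C suc (suc k)) + suc k * (suc n C suc k)
    ≡⟨ cong₂ (λ x y → suc (suc k) * x + suc k * y) (pascal (suc k)) (pascal k) ⟨
  suc (suc k) * (b + c) + suc k * (a + b)
    ≡⟨ regroup k a b c ⟩
  (suc (suc k) * c + suc k * b) + (suc k * b + k * a) + (a + b)
    ≡⟨ cong₂ (λ x y → x + y + (a + b)) (C-absorbˡ n (suc k)) (C-absorbˡ n k) ⟩
  n * b + n * a + (a + b)
    ≡⟨ collect n a b ⟩
  suc n * (a + b)
    ≡⟨ cong (suc n *_) (pascal k) ⟩
  suc n * (suc n C suc k) ∎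
  where
  open ≡-Reasoning
  pascal = nCk+nC[k+1]≡[n+1]C[k+1] n
  a = n C k
  b = n C suc k
  c = n C suc (suc k)
  regroup : ∀ k a b c → suc (suc k) * (b + c) + suc k * (a + b) ≡
                        (suc (suc k) * c + suc k * b) + (suc k * b + k * a) + (a + b)
  regroup = solve-∀
  collect : ∀ n a b → n * b + n * a + (a + b) ≡ suc n * (a + b)
  collect = solve-∀

-- (n+1−k)·C(n+1,k) = (n+1)·C(n,k), with the subtraction moved across.
C-absorbʳ : ∀ n k → suc n * (n C k) + k * (suc n C k) ≡ suc n * (suc n C k)
C-absorbʳ n zero    = +-identityʳ _
C-absorbʳ n (suc k) = begin
  suc n * b + suc k * (suc n C suc k)  ≡⟨ cong (λ x → suc n * b + suc k * x) (pascal k) ⟨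
  suc n * b + suc k * (a + b)          ≡⟨ regroup n k a b ⟩
  suc n * b + a + (suc k * b + k * a)  ≡⟨ cong (suc n * b + a +_) (C-absorbˡ n k) ⟩
  suc n * b + a + n * a                ≡⟨ collect n a b ⟩
  suc n * (a + b)                      ≡⟨ cong (suc n *_) (pascal k) ⟩
  suc n * (suc n C suc k)              ∎
  where
  open ≡-Reasoning
  pascal = nCk+nC[k+1]≡[n+1]C[k+1] n
  a = n C k
  b = n C suc k
  regroup : ∀ n k a b → suc n * b + suc k * (a + b) ≡ suc n * b + a + (suc k * b + k * a)
  regroup = solve-∀
  collect : ∀ n a b → suc n * b + a + n * a ≡ suc n * (a + b)
  collect = solve-∀

IsBinomCoeff-at-0 : ∀ s m → IsBinomCoeff s m 0 1
IsBinomCoeff-at-0 s m rewrite *-zeroʳ s | +-identityʳ m = refl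

IsBinomCoeff-0-suc : ∀ s n → IsBinomCoeff s 0 (suc n) 0
IsBinomCoeff-0-suc s n = *-zeroʳ (s * suc n)

IsBinomCoeff-pascal : ∀ r m k a b →
  IsBinomCoeff (suc r) m (suc k) a → IsBinomCoeff (suc r) (suc r + m) k b →
  IsBinomCoeff (suc r) (suc m) (suc k) (a + b)
IsBinomCoeff-pascal r m k a b Na≡md Nb≡m′c = *-cancelˡ-≡ _ _ N {{≢-nonZero (m+1+n≢0 m)}} (begin
  N * (suc N * (a + b))          ≡⟨ distribute N a b ⟩
  suc N * (N * a + N * b)        ≡⟨ cong₂ (λ x y → suc N * (x + y)) Na≡md Nb≡m′c′ ⟩
  suc N * (m * d + (s + m) * c)  ≡⟨ cleared ⟩
  N * (suc m * (c + d))          ≡⟨ cong (λ x → N * (suc m * x)) (nCk+nC[k+1]≡[n+1]C[k+1] N k) ⟩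
  N * (suc m * (suc N C suc k))  ∎)
  where
  open ≡-Reasoning
  s = suc r
  N = m + s * suc k
  c = N C k
  d = N C suc k
  index : ∀ r m k → suc r + m + suc r * k ≡ m + suc r * suc k
  index = solve-∀
  distribute : ∀ N a b → N * (suc N * (a + b)) ≡ suc N * (N * a + N * b)
  distribute = solve-∀
  -- both sides differ by s·((k+1)·C(N,k+1) + k·C(N,k) − N·C(N,k)), which vanishes by absorption
  key : ∀ m r k c d →
    suc (m + suc r * suc k) * (m * d + (suc r + m) * c) + suc r * (k * c + suc k * d)
    ≡ (m + suc r * suc k) * (suc m * (c + d)) + suc r * ((m + suc r * suc k) * c)
  key = solve-∀
  Nb≡m′c′ : N * b ≡ (s + m) * c
  Nb≡m′c′ = subst (λ x → x * b ≡ (s + m) * (x C k)) (index r m k) Nb≡m′c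
  absorb : s * (N * c) ≡ s * (k * c + suc k * d)
  absorb = cong (s *_) (sym (trans (+-comm (k * c) (suc k * d)) (C-absorbˡ N k)))
  cleared : suc N * (m * d + (s + m) * c) ≡ N * (suc m * (c + d))
  cleared = +-cancelʳ-≡ _ _ _ (trans (key m r k c d) (cong (N * (suc m * (c + d)) +_) absorb))

recurrence⇒IsBinomCoeff : ∀ r (T : ℕ → ℕ → ℕ) →
  (∀ m k → T (suc m) (suc k) ≡ T m (suc k) + T (suc r + m) k) →
  (∀ m → T m 0 ≡ 1) → (∀ k → T 0 (suc k) ≡ 0) →
  ∀ m k → IsBinomCoeff (suc r) m k (T m k)
recurrence⇒IsBinomCoeff r T T-suc T-at-0 T-0-suc = go
  where
  go : ∀ m k → IsBinomCoeff (suc r) m k (T m k)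
  go m       zero    = subst (IsBinomCoeff (suc r) m 0) (sym (T-at-0 m)) (IsBinomCoeff-at-0 (suc r) m)
  go zero    (suc k) = subst (IsBinomCoeff (suc r) 0 (suc k)) (sym (T-0-suc k))
                             (IsBinomCoeff-0-suc (suc r) k)
  go (suc m) (suc k) = subst (IsBinomCoeff (suc r) (suc m) (suc k)) (sym (T-suc m k))
                             (IsBinomCoeff-pascal r m k _ _ (go m (suc k)) (go (suc r + m) k))

IsBinomCoeff⇒closedForm : ∀ r m n c → IsBinomCoeff (suc r) (suc m) n c →
                          (suc m + r * n) * c ≡ suc m * ((m + r * n + n) C n)
IsBinomCoeff⇒closedForm r m n c Pc≡mC = *-cancelˡ-≡ _ _ (suc P) (begin
  suc P * (M * c)            ≡⟨ swap (suc P) M c ⟩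
  M * (suc P * c)            ≡⟨ cong (M *_) Pc≡mC′ ⟩
  M * (suc m * (suc P C n))  ≡⟨ swap M (suc m) _ ⟩
  suc m * (M * (suc P C n))  ≡⟨ cong (suc m *_) MC≡PC ⟩
  suc m * (suc P * (P C n))  ≡⟨ swap (suc m) (suc P) _ ⟩
  suc P * (suc m * (P C n))  ∎)
  where
  open ≡-Reasoning
  P = m + r * n + n
  M = suc m + r * n
  swap : ∀ x y z → x * (y * z) ≡ y * (x * z)
  swap = solve-∀
  index : ∀ m r n → suc m + suc r * n ≡ suc (m + r * n + n)
  index = solve-∀
  split : ∀ m r n x → suc (m + r * n + n) * x ≡ (suc m + r * n) * x + n * x
  split = solve-∀
  Pc≡mC′ : suc P * c ≡ suc m * (suc P C n)
  Pc≡mC′ = subst (λ x → x * c ≡ suc m * (x C n)) (index m r n) Pc≡mC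
  MC≡PC : M * (suc P C n) ≡ suc P * (P C n)
  MC≡PC = +-cancelʳ-≡ (n * (suc P C n)) _ _ (trans (sym (split m r n _)) (sym (C-absorbʳ P n)))

module ℕ⟦t⟧ = FormalPowerSeries +-*-semiring
module ℕ⟦t⟧⟦x⟧ = FormalPowerSeries ℕ⟦t⟧.semiring
open ℕ⟦t⟧⟦x⟧
open ℕ⟦t⟧ using ()
  renaming (_≋_ to _≋ₜ_; _⊛_ to _⊛ₜ_; 𝟘 to 𝟘ₜ; 𝟙 to 𝟙ₜ; ≋-refl to ≋ₜ-refl; ≋-trans to ≋ₜ-trans)
open SemiringSum ℕ⟦t⟧.semiring using (∑; ∑-map-cong; ∑-applyUpTo-single)

t : ℕ⟦t⟧.FPS
t = ℕ⟦t⟧.x· 𝟙ₜ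

t-⊛ : ∀ p → t ⊛ₜ p ≋ₜ ℕ⟦t⟧.x· p
t-⊛ p = ≋ₜ-trans (ℕ⟦t⟧.⊛-x·ˡ 𝟙ₜ p) (ℕ⟦t⟧.x·-cong (ℕ⟦t⟧.⊛-identityˡ p))

t-central : ∀ p → p ⊛ₜ t ≋ₜ t ⊛ₜ p
t-central p = ≋ₜ-trans (ℕ⟦t⟧.⊛-x·ʳ p 𝟙ₜ)
             (≋ₜ-trans (ℕ⟦t⟧.x·-cong (ℕ⟦t⟧.⊛-identityʳ p)) (ℕ⟦t⟧.≋-sym (t-⊛ p)))

divisors-bpow : ∀ r k → divisors (bpow r k) ≡ map (bpow r) (upTo (suc k))
divisors-bpow zero    k = concatMap-singleton (upTo (suc k))
  where
  concatMap-singleton : ∀ (xs : List ℕ) → concatMap (λ j → map (j ∷_) ([] ∷ [])) xs ≡ map (_∷ []) xs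
  concatMap-singleton []       = refl
  concatMap-singleton (x ∷ xs) = cong ((x ∷ []) ∷_) (concatMap-singleton xs)
divisors-bpow (suc r) k = begin
  map (0 ∷_) (divisors (bpow r k)) ++ []     ≡⟨ ++-identityʳ _ ⟩
  map (0 ∷_) (divisors (bpow r k))           ≡⟨ cong (map (0 ∷_)) (divisors-bpow r k) ⟩
  map (0 ∷_) (map (bpow r) (upTo (suc k)))   ≡⟨ map-∘ (upTo (suc k)) ⟨
  map (bpow (suc r)) (upTo (suc k))          ∎
  where open ≡-Reasoning

monoDiv-bpow : ∀ r k j → monoDiv (bpow r k) (bpow r j) ≡ bpow r (k ∸ j)
monoDiv-bpow zero    k j = refl
monoDiv-bpow (suc r) k j = cong (0 ∷_) (monoDiv-bpow r k j)

1ₚ-bpow : ∀ r k → 1ₚ (bpow r k) ≡ 𝟙ₜ k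
1ₚ-bpow zero    zero    = refl
1ₚ-bpow zero    (suc k) = refl
1ₚ-bpow (suc r) k       = 1ₚ-bpow r k

bvar-bpow : ∀ r k → bvar r (bpow r k) ≡ t k
bvar-bpow zero    zero          = refl
bvar-bpow zero    (suc zero)    = refl
bvar-bpow zero    (suc (suc k)) = refl
bvar-bpow (suc r) k             = bvar-bpow r k

bvar-bpow-≢ : ∀ i r k → i ≢ r → bvar i (bpow r k) ≡ 0
bvar-bpow-≢ zero    zero    k       i≢r = contradiction refl i≢r
bvar-bpow-≢ zero    (suc r) k       i≢r = refl
bvar-bpow-≢ (suc i) zero    zero    i≢r = bvar-[] i
  where
  bvar-[] : ∀ i → bvar i [] ≡ 0
  bvar-[] zero    = refl
  bvar-[] (suc i) = refl
bvar-bpow-≢ (suc i) zero    (suc k) i≢r = refl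
bvar-bpow-≢ (suc i) (suc r) k       i≢r = bvar-bpow-≢ i r k (i≢r ∘ cong suc)

module Restriction (r : ℕ) where

  restrictₚ : Poly → ℕ⟦t⟧.FPS
  restrictₚ p k = p (bpow r k)

  restrict : Series → FPS
  restrict f n = restrictₚ (f n)

  restrictₚ-* : ∀ p q → restrictₚ (p *ₚ q) ≋ₜ restrictₚ p ⊛ₜ restrictₚ q
  restrictₚ-* p q k = begin
    sum (map term (divisors (bpow r k)))
      ≡⟨ cong (sum ∘ map term) (divisors-bpow r k) ⟩
    sum (map term (map (bpow r) (upTo (suc k))))
      ≡⟨ cong sum (map-∘ (upTo (suc k))) ⟨
    sum (map (term ∘ bpow r) (upTo (suc k)))
      ≡⟨ cong sum (map-cong quotient (upTo (suc k))) ⟩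
    sum (map (λ j → p (bpow r j) * q (bpow r (k ∸ j))) (upTo (suc k)))
      ≡⟨ ℕ⟦t⟧.⊛-coeff (restrictₚ p) (restrictₚ q) k ⟨
    (restrictₚ p ⊛ₜ restrictₚ q) k ∎
    where
    open ≡-Reasoning
    term : Mono → ℕ
    term ν = p ν * q (monoDiv (bpow r k) ν)
    quotient : ∀ j → term (bpow r j) ≡ p (bpow r j) * q (bpow r (k ∸ j))
    quotient j = cong (λ μ → p (bpow r j) * q μ) (monoDiv-bpow r k j)

  restrictₚ-sum : ∀ ps → restrictₚ (sumₚ ps) ≋ₜ ∑ (map restrictₚ ps)
  restrictₚ-sum []       k = refl
  restrictₚ-sum (p ∷ ps) k = cong (p (bpow r k) +_) (restrictₚ-sum ps k)

  restrictₚ-sum-map : ∀ (P : ℕ → Poly) n →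
                      restrictₚ (sumₚ (map P (upTo n))) ≋ₜ ∑ (map (restrictₚ ∘ P) (upTo n))
  restrictₚ-sum-map P n k =
    trans (restrictₚ-sum (map P (upTo n)) k) (cong (λ ps → ∑ ps k) (sym (map-∘ (upTo n))))

  restrict-1 : restrict 1ₛ ≋ 𝟙
  restrict-1 zero    = 1ₚ-bpow r
  restrict-1 (suc n) = ≋ₜ-refl

  restrict-x : ∀ f → restrict (xₛ* f) ≋ x· restrict f
  restrict-x f zero    = ≋ₜ-refl
  restrict-x f (suc n) = ≋ₜ-refl

  restrict-x² : ∀ f → restrict (x²ₛ* f) ≋ x^ 2 · restrict f
  restrict-x² f zero          = ≋ₜ-refl
  restrict-x² f (suc zero)    = ≋ₜ-refl
  restrict-x² f (suc (suc n)) = ≋ₜ-refl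

  restrict-* : ∀ f h → restrict (f *ₛ h) ≋ restrict f ⊛ restrict h
  restrict-* f h n = begin
    restrictₚ (sumₚ (map (λ a → f a *ₚ h (n ∸ a)) (upTo (suc n))))
      ≈⟨ restrictₚ-sum-map (λ a → f a *ₚ h (n ∸ a)) (suc n) ⟩
    ∑ (map (λ a → restrictₚ (f a *ₚ h (n ∸ a))) (upTo (suc n)))
      ≈⟨ ∑-map-cong (λ a → restrictₚ-* (f a) (h (n ∸ a))) (upTo (suc n)) ⟩
    ∑ (map (λ a → restrict f a ⊛ₜ restrict h (n ∸ a)) (upTo (suc n)))
      ≈⟨ ⊛-coeff (restrict f) (restrict h) n ⟨
    (restrict f ⊛ restrict h) n ∎
    where open SetoidReasoning (Semiring.setoid ℕ⟦t⟧.semiring)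

  restrict-^ : ∀ f i → restrict (f ^ₛ i) ≋ restrict f ^ i
  restrict-^ f zero    = restrict-1
  restrict-^ f (suc i) = ≋-trans (restrict-* f (f ^ₛ i)) (⊛-cong ≋-refl (restrict-^ f i))

  restrict-B : ∀ y → restrict y 0 ≋ₜ 𝟘ₜ → restrict (B∘ y) ≋ t ⋆ restrict y ^ r
  restrict-B y y₀≋0 n = begin
    restrictₚ (sumₚ (map (λ i → bvar i *ₚ (y ^ₛ i) n) (upTo (suc n))))
      ≈⟨ restrictₚ-sum-map (λ i → bvar i *ₚ (y ^ₛ i) n) (suc n) ⟩
    ∑ (map (λ i → restrictₚ (bvar i *ₚ (y ^ₛ i) n)) (upTo (suc n)))
      ≈⟨ ∑-map-cong (λ i → restrictₚ-* (bvar i) ((y ^ₛ i) n)) (upTo (suc n)) ⟩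
    ∑ (map term (upTo (suc n)))
      ≡⟨ cong ∑ (map-upTo term (suc n)) ⟩
    ∑ (applyUpTo term (suc n))
      ≈⟨ ∑-applyUpTo-single term (suc n) r term-≢ term-≥ ⟩
    term r
      ≈⟨ ℕ⟦t⟧.⊛-cong (bvar-bpow r) (restrict-^ y r n) ⟩
    (t ⋆ restrict y ^ r) n ∎
    where
    open SetoidReasoning (Semiring.setoid ℕ⟦t⟧.semiring)
    term : ℕ → ℕ⟦t⟧.FPS
    term i = restrictₚ (bvar i) ⊛ₜ restrict (y ^ₛ i) n
    term-≢ : ∀ i → i ≢ r → term i ≋ₜ 𝟘ₜ
    term-≢ i i≢r = ≋ₜ-trans (ℕ⟦t⟧.⊛-cong (λ k → bvar-bpow-≢ i r k i≢r) ≋ₜ-refl) (ℕ⟦t⟧.⊛-zeroˡ _)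
    term-≥ : suc n ≤ r → term r ≋ₜ 𝟘ₜ
    term-≥ n<r = ≋ₜ-trans (ℕ⟦t⟧.⊛-cong ≋ₜ-refl (≋ₜ-trans (restrict-^ y r n) y^r-vanishes))
                          (ℕ⟦t⟧.⊛-zeroʳ _)
      where
      y^r-vanishes : (restrict y ^ r) n ≋ₜ 𝟘ₜ
      y^r-vanishes = ^-vanish (restrict y) y₀≋0 r n n<r

  restrict-IsG : ∀ g → IsG g → restrict g ≋ 𝟙 ⊕ x^ (2 * r + 1) · (t ⋆ restrict g ^ suc r)
  restrict-IsG g isG = begin
    G
      ≈⟨ (λ n k → isG n (bpow r k)) ⟩
    restrict (1ₛ +ₛ xₛ* (g *ₛ B∘ (x²ₛ* g)))
      ≈⟨ ⊕-cong restrict-1 (≋-trans (restrict-x _) (x·-cong product)) ⟩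
    𝟙 ⊕ x^ suc (r * 2) · (t ⋆ G ^ suc r)
      ≡⟨ cong (λ j → 𝟙 ⊕ x^ j · (t ⋆ G ^ suc r)) exponent ⟩
    𝟙 ⊕ x^ (2 * r + 1) · (t ⋆ G ^ suc r) ∎
    where
    open SetoidReasoning (Semiring.setoid ℕ⟦t⟧⟦x⟧.semiring)
    G : FPS
    G = restrict g
    product : restrict (g *ₛ B∘ (x²ₛ* g)) ≋ x^ (r * 2) · (t ⋆ G ^ suc r)
    product = begin
      restrict (g *ₛ B∘ (x²ₛ* g))       ≈⟨ restrict-* g (B∘ (x²ₛ* g)) ⟩
      G ⊛ restrict (B∘ (x²ₛ* g))        ≈⟨ ⊛-cong ≋-refl (restrict-B (x²ₛ* g) ≋ₜ-refl) ⟩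
      G ⊛ (t ⋆ restrict (x²ₛ* g) ^ r)   ≈⟨ ⊛-cong ≋-refl (⋆-cong t (^-cong (restrict-x² g) r)) ⟩
      G ⊛ (t ⋆ (x^ 2 · G) ^ r)          ≈⟨ ⊛-cong ≋-refl (⋆-cong t (^-x^· 2 G r)) ⟩
      G ⊛ (t ⋆ x^ (r * 2) · G ^ r)      ≈⟨ ⊛-⋆-comm t t-central G _ ⟩
      t ⋆ (G ⊛ x^ (r * 2) · G ^ r)      ≈⟨ ⋆-cong t (⊛-x^·ʳ (r * 2) G (G ^ r)) ⟩
      t ⋆ x^ (r * 2) · G ^ suc r        ≈⟨ ⋆-x^· t (r * 2) (G ^ suc r) ⟩
      x^ (r * 2) · (t ⋆ G ^ suc r)      ∎
    exponent : suc (r * 2) ≡ 2 * r + 1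
    exponent = trans (cong suc (*-comm r 2)) (+-comm 1 (2 * r))

diagonal : ℕ → FPS → ℕ → ℕ
diagonal w F k = F (k * w) k

𝟙-at-t^suc : ∀ n k → 𝟙 n (suc k) ≡ 0
𝟙-at-t^suc zero    k = refl
𝟙-at-t^suc (suc n) k = refl

x^·-t⋆-at-t⁰ : ∀ w F n → (x^ w · (t ⋆ F)) n 0 ≡ 0
x^·-t⋆-at-t⁰ zero    F n       = refl
x^·-t⋆-at-t⁰ (suc w) F zero    = refl
x^·-t⋆-at-t⁰ (suc w) F (suc n) = x^·-t⋆-at-t⁰ w F n

diagonal-x^·-t⋆ : ∀ w F k → diagonal w (x^ w · (t ⋆ F)) (suc k) ≡ diagonal w F k
diagonal-x^·-t⋆ w F k = begin
  (x^ w · (t ⋆ F)) (w + k * w) (suc k)  ≡⟨ cong (λ n → (x^ w · (t ⋆ F)) n (suc k)) (+-comm w (k * w)) ⟩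
  (x^ w · (t ⋆ F)) (k * w + w) (suc k)  ≡⟨ cong-app (x^·-coeff w (t ⋆ F) (k * w)) (suc k) ⟩
  (t ⊛ₜ F (k * w)) (suc k)              ≡⟨ t-⊛ (F (k * w)) (suc k) ⟩
  F (k * w) k                           ∎
  where open ≡-Reasoning

module DiagonalOfPowers (w e : ℕ) (G : FPS) (G-eq : G ≋ 𝟙 ⊕ x^ w · (t ⋆ G ^ e)) where

  diagonal-^-suc : ∀ m k → diagonal w (G ^ suc m) (suc k)
                           ≡ diagonal w (G ^ m) (suc k) + diagonal w (G ^ (e + m)) k
  diagonal-^-suc m k =
    trans (^-suc-fixedPoint t w e G G-eq m (suc k * w) (suc k))
          (cong (diagonal w (G ^ m) (suc k) +_) (diagonal-x^·-t⋆ w (G ^ (e + m)) k))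

  diagonal-^-at-0 : ∀ m → diagonal w (G ^ m) 0 ≡ 1
  diagonal-^-at-0 zero    = refl
  diagonal-^-at-0 (suc m) = trans (^-suc-fixedPoint t w e G G-eq m 0 0)
                                  (cong₂ _+_ (diagonal-^-at-0 m) (x^·-t⋆-at-t⁰ w (G ^ (e + m)) 0))

  diagonal-^0-suc : ∀ k → diagonal w (G ^ 0) (suc k) ≡ 0
  diagonal-^0-suc k = 𝟙-at-t^suc (suc k * w) k

theorem5 : (g : Series) → IsG g → (m : ℕ) → 1 ≤ m → (r mr : ℕ) →
    IsBinomCoeff (suc r) m mr ((g ^ₛ m) (mr * (2 * r + 1)) (bpow r mr))
    × ((m + r * mr) * (g ^ₛ m) (mr * (2 * r + 1)) (bpow r mr)
        ≡ m * ((m + r * mr + mr ∸ 1) C mr))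
-- At m = suc m′ the truncated subtraction m + r * mr + mr ∸ 1 reduces to m′ + r * mr + mr.
theorem5 g isG (suc m′) (s≤s z≤n) r k = isBinom , IsBinomCoeff⇒closedForm r m′ k _ isBinom
  where
  open Restriction r
  open DiagonalOfPowers (2 * r + 1) (suc r) (restrict g) (restrict-IsG g isG)
  T : ℕ → ℕ → ℕ
  T m = diagonal (2 * r + 1) (restrict g ^ m)
  isBinom : IsBinomCoeff (suc r) (suc m′) k ((g ^ₛ suc m′) (k * (2 * r + 1)) (bpow r k))
  isBinom = subst (IsBinomCoeff (suc r) (suc m′) k) (sym (restrict-^ g (suc m′) (k * (2 * r + 1)) k))
                  (recurrence⇒IsBinomCoeff r T diagonal-^-suc diagonal-^-at-0 diagonal-^0-suc (suc m′) k)
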